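{- Let $a,b,c$ be nonzero integers and let $\mathcal{E}$ denote the equation $ax+by+cz=0$. Suppose $\mathcal{E}$ is not regular and that for some prime $p$, $$0=v_p(a)=v_p(b)=v_p(a+b)<v_p(c)=:r.$$ Then $dor(\mathcal{E})<6$. If additionally the element $-ab^{ -1}$ of the multiplicative group $(\mathbb{Z}/p^r\mathbb{Z})^\times$ has even order, then $dor(\mathcal{E})<4$.
   Context: For a prime $p$ and nonzero integer $x$, $v_p(x)$ is the largest integer $n$ with $p^n\mid x$. A linear equation $\mathcal{E}$ is $k$-regular if every coloring of the positive integers with $k$ colors admits a monochromatic solution to $\mathcal{E}$ in positive integers; it is regular if it is $k$-regular for every $k\ge1$. The degree of regularity $dor(\mathcal{E})$ is the largest $k$ for which $\mathcal{E}$ is $k$-regular ($\infty$ if regular). -}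

module Defs where

open import Data.Nat as ℕ using (ℕ; suc)
open import Data.Integer as ℤ using (ℤ; +_; _+_; _*_; _-_; -_; _^_)
open import Data.Integer.Divisibility using (_∣_)
open import Data.Fin using (Fin)
open import Data.Product using (Σ; ∃; _×_; _,_)
open import Relation.Binary.PropositionalEquality using (_≡_)
open import Relation.Nullary using (¬_)

record Equation : Set where
  constructor eqn
  field
    a b c : ℤ

SolvesPos : Equation → ℕ → ℕ → ℕ → Set
SolvesPos (eqn a b c) x y z =
  1 ℕ.≤ x × 1 ℕ.≤ y × 1 ℕ.≤ z × (a * + x + b * + y + c * + z ≡ + 0)

-- k-regular: every k-colouring of the positive integers admits a
-- monochromatic solution in positive integers.  (The colouring is a
-- function on ℕ; its value at 0 is irrelevant since solutions are positive.)
KRegular : ℕ → Equation → Set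
KRegular k E = (χ : ℕ → Fin k) →
  Σ ℕ λ x → Σ ℕ λ y → Σ ℕ λ z →
    SolvesPos E x y z × χ x ≡ χ y × χ y ≡ χ z

Regular : Equation → Set
Regular E = (k : ℕ) → 1 ℕ.≤ k → KRegular k E

-- dor(E) < n : the largest k for which E is k-regular is < n, i.e.
-- E is not k-regular for any k ≥ n.
DorLessThan : Equation → ℕ → Set
DorLessThan E n = (k : ℕ) → n ℕ.≤ k → ¬ KRegular k E

Valuation : ℕ → ℤ → ℕ → Set
Valuation p x v = ¬ (x ≡ + 0) × ((+ p) ^ v ∣ x) × ¬ ((+ p) ^ suc v ∣ x)

IsInverseMod : ℕ → ℤ → ℤ → Set
IsInverseMod n b binv = + n ∣ (b * binv - + 1)

IsMultOrder : ℕ → ℤ → ℕ → Set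
IsMultOrder n g m =
  1 ℕ.≤ m × (+ n ∣ (g ^ m - + 1)) ×
  ((m' : ℕ) → 1 ℕ.≤ m' → m' ℕ.< m → ¬ (+ n ∣ (g ^ m' - + 1)))

-- Let Q ≡ -a b⁻¹ (mod p), so that a x + b y ≡ 0 (mod p) with p ∤ x forces y ≡ Q x, and let d be
-- the order of Q modulo p; d > 1 because p ∤ a + b.  Colour each unit u modulo p through a proper
-- colouring of the cycle u, Q u, Q² u, … of length d, so that u and Q u always get different
-- colours (three colours suffice, two when d is even), and colour n = p^v u with p ∤ u by the pair
-- (parity of ⌊v / r⌋, colour of u).  In a monochromatic solution write the three terms as
-- p^α U₁ + p^β U₂ + p^(γ + r) U₃ with p ∤ Uᵢ; the lowest power of p must occur twice.  If it is
-- α = γ + r (or β = γ + r), then ⌊α / r⌋ = ⌊γ / r⌋ + 1 has the other parity; if α = β < γ + r, then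
-- p ∣ a x' + b y', so y' ≡ Q x' and the colours of x', y' differ.  This rules out 2·3 = 6 colours,
-- and 2·2 = 4 when d is even.  For the second claim: Q^d ≡ 1 (mod p) lifts to Q^(d p^(r-1)) ≡ 1
-- (mod p^r), so the even order of Q modulo p^r divides d p^(r-1); p = 2 is impossible since then
-- Q ≡ 1 (mod 2) and d = 1, hence d is even.

module Submission where

open import Defs
open import Data.Nat using (ℕ; _≤_; _<_) renaming (_^_ to _^ℕ_)
open import Data.Nat.Primality using (Prime)
open import Data.Nat.Divisibility using () renaming (_∣_ to _∣ℕ_)
open import Data.Integer using (ℤ; +_; _+_; _*_; -_; _^_)
open import Data.Product using (_×_)
open import Relation.Binary.PropositionalEquality using (_≡_)
open import Relation.Nullary using (¬_)

open import Data.Nat as ℕ using (zero; suc; z≤n; s≤s)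
import Data.Nat.Properties as ℕP
import Data.Nat.Divisibility as ℕD
open import Data.Nat.DivMod using (_%_; _/_; m≡m%n+[m/n]*n; m%n<n; m/n≡1+[m∸n]/n)
open import Data.Nat.Primality
  using (euclidsLemma; prime⇒nonZero; prime⇒nonTrivial; prime⇒irreducible; prime[2])
import Data.Nat.Induction as ℕI
import Data.Nat.Tactic.RingSolver as ℕSolver
open import Data.Integer using (_-_)
import Data.Integer as ℤ
import Data.Integer.Properties as ℤP
open import Data.Integer.Divisibility.Signed
  using (_∣_; divides; _∣?_; ∣-refl; ∣-reflexive; ∣-trans; *-monoʳ-∣; *-cancelˡ-∣;
         ∣m∣n⇒∣m+n; ∣n⇒∣m*n; ∣m⇒∣m*n; ∣ᵤ⇒∣; ∣⇒∣ᵤ)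
open import Data.Integer.DivMod using (_%ℕ_; _/ℕ_; n%ℕd<d; a≡a%ℕn+[a/ℕn]*n)
open import Data.Integer.Tactic.RingSolver using (solve-∀; solve)
open import Data.Fin as Fin using (Fin)
import Data.Fin.Properties as FinP
open import Data.List using ([]; _∷_)
open import Data.Product using (_,_; proj₁; proj₂; uncurry; ∃-syntax)
open import Data.Product.Properties using (×-≡,≡→≡)
open import Data.Sum using (_⊎_; inj₁; inj₂; [_,_]′)
open import Data.Empty using (⊥; ⊥-elim)
open import Function using (_∘_)
open import Induction.WellFounded using (Acc; acc)
open import Level using (0ℓ)
open import Relation.Nullary using (Dec; yes; no)
open import Relation.Nullary.Decidable using (map′; _×-dec_)
open import Relation.Unary using (Pred; Decidable; _≐_)
open import Relation.Binary using (Setoid; IsEquivalence)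
open import Relation.Binary.Definitions using (Tri; tri<; tri≈; tri>)
open import Relation.Binary.PropositionalEquality
  using (_≢_; refl; sym; trans; cong; cong₂; subst; subst₂; module ≡-Reasoning)
import Relation.Binary.Reasoning.Setoid

-- Congruences modulo an integer

∣-linear : ∀ {m x y z} u v → z ≡ u * x + v * y → m ∣ x → m ∣ y → m ∣ z
∣-linear u v refl m∣x m∣y = ∣m∣n⇒∣m+n (∣n⇒∣m*n u m∣x) (∣n⇒∣m*n v m∣y)

∣-scale : ∀ {m x z} u → z ≡ u * x → m ∣ x → m ∣ z
∣-scale u refl m∣x = ∣n⇒∣m*n u m∣x

∣0 : ∀ m → m ∣ + 0
∣0 m = divides (+ 0) (sym (ℤP.*-zeroˡ m))

^-monoʳ-∣ : ∀ x {m n} → m ≤ n → x ^ m ∣ x ^ n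
^-monoʳ-∣ x {m} {n} m≤n = divides (x ^ (n ℕ.∸ m)) (begin
  x ^ n                    ≡⟨ cong (x ^_) (ℕP.m+[n∸m]≡n m≤n) ⟨
  x ^ (m ℕ.+ (n ℕ.∸ m))    ≡⟨ ℤP.^-distribˡ-+-* x m (n ℕ.∸ m) ⟩
  x ^ m * x ^ (n ℕ.∸ m)    ≡⟨ ℤP.*-comm (x ^ m) (x ^ (n ℕ.∸ m)) ⟩
  x ^ (n ℕ.∸ m) * x ^ m    ∎)
  where open ≡-Reasoning

+-swap : ∀ x y z → x + y + z ≡ + 0 → y + x + z ≡ + 0
+-swap x y z = trans (cong (_+ z) (ℤP.+-comm y x))

+-rotate : ∀ x y z → x + y + z ≡ + 0 → y + z + x ≡ + 0
+-rotate x y z = trans (eq x y z)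
  where
  eq : ∀ x y z → y + z + x ≡ x + y + z
  eq = solve-∀

infix 4 _≡_mod_
record _≡_mod_ (x y m : ℤ) : Set where
  constructor ∣⇒≡mod
  field ≡mod⇒∣ : m ∣ x - y
open _≡_mod_ public

module _ {m : ℤ} where

  ≡mod-refl : ∀ {x} → x ≡ x mod m
  ≡mod-refl {x} = ∣⇒≡mod (subst (m ∣_) (sym (ℤP.+-inverseʳ x)) (∣0 m))

  ≡mod-reflexive : ∀ {x y} → x ≡ y → x ≡ y mod m
  ≡mod-reflexive refl = ≡mod-refl

  ≡mod-sym : ∀ {x y} → x ≡ y mod m → y ≡ x mod m
  ≡mod-sym {x} {y} (∣⇒≡mod m∣x-y) = ∣⇒≡mod (∣-scale (- + 1) (eq x y) m∣x-y)
    where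
    eq : ∀ x y → y - x ≡ - + 1 * (x - y)
    eq = solve-∀

  ≡mod-trans : ∀ {x y z} → x ≡ y mod m → y ≡ z mod m → x ≡ z mod m
  ≡mod-trans {x} {y} {z} (∣⇒≡mod m∣x-y) (∣⇒≡mod m∣y-z) =
    ∣⇒≡mod (∣-linear (+ 1) (+ 1) (eq x y z) m∣x-y m∣y-z)
    where
    eq : ∀ x y z → x - z ≡ + 1 * (x - y) + + 1 * (y - z)
    eq = solve-∀

  ≡mod-isEquivalence : IsEquivalence (λ x y → x ≡ y mod m)
  ≡mod-isEquivalence = record
    { refl = ≡mod-refl ; sym = ≡mod-sym ; trans = ≡mod-trans }

  *-congˡ-≡mod : ∀ {x y} z → x ≡ y mod m → z * x ≡ z * y mod m
  *-congˡ-≡mod {x} {y} z (∣⇒≡mod m∣x-y) = ∣⇒≡mod (∣-scale z (eq x y z) m∣x-y)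
    where
    eq : ∀ x y z → z * x - z * y ≡ z * (x - y)
    eq = solve-∀

  ^-≡mod-1 : ∀ {x} k → x ≡ + 1 mod m → x ^ k ≡ + 1 mod m
  ^-≡mod-1 zero x≡1 = ≡mod-refl
  ^-≡mod-1 {x} (suc k) (∣⇒≡mod m∣x-1) =
    ∣⇒≡mod (∣-linear x (+ 1) (eq x (x ^ k)) (≡mod⇒∣ (^-≡mod-1 k (∣⇒≡mod m∣x-1))) m∣x-1)
    where
    eq : ∀ x y → x * y - + 1 ≡ x * (y - + 1) + + 1 * (x - + 1)
    eq = solve-∀

  *-≡mod-1-cancelʳ : ∀ {x y} → x * y ≡ + 1 mod m → y ≡ + 1 mod m → x ≡ + 1 mod m
  *-≡mod-1-cancelʳ {x} {y} (∣⇒≡mod m∣xy-1) (∣⇒≡mod m∣y-1) =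
    ∣⇒≡mod (∣-linear (+ 1) (- x) (eq x y) m∣xy-1 m∣y-1)
    where
    eq : ∀ x y → x - + 1 ≡ + 1 * (x * y - + 1) + - x * (y - + 1)
    eq = solve-∀

≡mod-setoid : ℤ → Setoid 0ℓ 0ℓ
≡mod-setoid m = record { isEquivalence = ≡mod-isEquivalence {m} }

module ≡mod-Reasoning (m : ℤ) = Relation.Binary.Reasoning.Setoid (≡mod-setoid m)

≡mod-weaken : ∀ {m n x y} → m ∣ n → x ≡ y mod n → x ≡ y mod m
≡mod-weaken m∣n (∣⇒≡mod n∣x-y) = ∣⇒≡mod (∣-trans m∣n n∣x-y)

infix 4 _≡mod?_
_≡mod?_ : ∀ {m} x y → Dec (x ≡ y mod m)
_≡mod?_ {m} x y = map′ ∣⇒≡mod ≡mod⇒∣ (m ∣? (x - y))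

geometric : ℤ → ℕ → ℤ
geometric w zero = + 0
geometric w (suc n) = w ^ n + geometric w n

^-1≡[w-1]*geometric : ∀ w n → w ^ n - + 1 ≡ (w - + 1) * geometric w n
^-1≡[w-1]*geometric w zero = solve (w ∷ [])
^-1≡[w-1]*geometric w (suc n) = begin
  w * w ^ n - + 1
    ≡⟨ eq w (w ^ n) ⟩
  (w - + 1) * w ^ n + (w ^ n - + 1)
    ≡⟨ cong (λ t → (w - + 1) * w ^ n + t) (^-1≡[w-1]*geometric w n) ⟩
  (w - + 1) * w ^ n + (w - + 1) * geometric w n
    ≡⟨ ℤP.*-distribˡ-+ (w - + 1) (w ^ n) (geometric w n) ⟨
  (w - + 1) * (w ^ n + geometric w n)
    ∎
  where
  open ≡-Reasoning
  eq : ∀ w v → w * v - + 1 ≡ (w - + 1) * v + (v - + 1)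
  eq = solve-∀

geometric-≡mod : ∀ {m w} → w ≡ + 1 mod m → ∀ n → geometric w n ≡ + n mod m
geometric-≡mod w≡1 zero = ≡mod-refl
geometric-≡mod {m} {w} w≡1 (suc n) =
  ∣⇒≡mod (∣-linear (+ 1) (+ 1) (eq (w ^ n) (geometric w n) (+ n))
            (≡mod⇒∣ (^-≡mod-1 n w≡1)) (≡mod⇒∣ (geometric-≡mod w≡1 n)))
  where
  eq : ∀ v g k → v + g - (+ 1 + k) ≡ + 1 * (v - + 1) + + 1 * (g - k)
  eq = solve-∀

-- Least witnesses and multiplicative orders

Least : Pred ℕ 0ℓ → ℕ → Set
Least P n = P n × (∀ {j} → j < n → ¬ P j)

module _ {P : Pred ℕ 0ℓ} (P? : Decidable P) where

  private
    search : ∀ n → (∀ {j} → j < n → ¬ P j) ⊎ ∃[ m ] m < n × Least P m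
    search zero = inj₁ λ ()
    search (suc n) with search n
    ... | inj₂ (m , m<n , least-m) = inj₂ (m , ℕP.m<n⇒m<1+n m<n , least-m)
    ... | inj₁ none-below with P? n
    ...   | yes Pn = inj₂ (n , ℕP.n<1+n n , Pn , none-below)
    ...   | no ¬Pn = inj₁ none-upto
      where
      none-upto : ∀ {j} → j < suc n → ¬ P j
      none-upto j<1+n with ℕP.m<1+n⇒m<n∨m≡n j<1+n
      ... | inj₁ j<n = none-below j<n
      ... | inj₂ refl = ¬Pn

  least : ∀ {n} → P n → ∃[ m ] m ≤ n × Least P m
  least {n} Pn with search (suc n)
  ... | inj₁ none = ⊥-elim (none (ℕP.n<1+n n) Pn)
  ... | inj₂ (m , m<1+n , least-m) = m , ℕ.s≤s⁻¹ m<1+n , least-m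

Least-unique : ∀ {P : Pred ℕ 0ℓ} {m n} → Least P m → Least P n → m ≡ n
Least-unique {m = m} {n} (Pm , m-least) (Pn , n-least) with ℕP.<-cmp m n
... | tri< m<n _ _ = ⊥-elim (n-least m<n Pm)
... | tri≈ _ m≡n _ = m≡n
... | tri> _ _ n<m = ⊥-elim (m-least n<m Pn)

Least-≐ : ∀ {P Q : Pred ℕ 0ℓ} {m} → P ≐ Q → Least P m → Least Q m
Least-≐ (P⊆Q , Q⊆P) (Pm , m-least) = P⊆Q Pm , λ j<m Qj → m-least j<m (Q⊆P Qj)

IsOrder : ℤ → ℤ → ℕ → Set
IsOrder m w = Least (λ j → 0 < j × w ^ j ≡ + 1 mod m)

order-exists : ∀ {m w} → ∃[ n ] 0 < n × w ^ n ≡ + 1 mod m → ∃[ d ] IsOrder m w d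
order-exists {m} {w} (_ , 0<n , w^n≡1) =
  let d , _ , order = least (λ j → (0 ℕP.<? j) ×-dec (w ^ j ≡mod? + 1)) (0<n , w^n≡1) in d , order

order-∣ : ∀ {m w d n} → IsOrder m w d → w ^ n ≡ + 1 mod m → d ∣ℕ n
order-∣ {d = zero} ((() , _) , _)
order-∣ {m} {w} {d@(suc _)} {n} ((_ , w^d≡1) , minimal) w^n≡1 with n % d ℕ.≟ 0
... | yes n%d≡0 = ℕD.m%n≡0⇒n∣m n d n%d≡0
... | no n%d≢0 = ⊥-elim (minimal (m%n<n n d) (ℕP.n≢0⇒n>0 n%d≢0 , w^[n%d]≡1))
  where
  split : w ^ n ≡ w ^ (n % d) * (w ^ d) ^ (n / d)
  split = begin
    w ^ n                                ≡⟨ cong (w ^_) (m≡m%n+[m/n]*n n d) ⟩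
    w ^ (n % d ℕ.+ n / d ℕ.* d)          ≡⟨ ℤP.^-distribˡ-+-* w (n % d) (n / d ℕ.* d) ⟩
    w ^ (n % d) * w ^ (n / d ℕ.* d)      ≡⟨ cong (λ e → w ^ (n % d) * w ^ e) (ℕP.*-comm (n / d) d) ⟩
    w ^ (n % d) * w ^ (d ℕ.* (n / d))    ≡⟨ cong (w ^ (n % d) *_) (ℤP.^-*-assoc w d (n / d)) ⟨
    w ^ (n % d) * (w ^ d) ^ (n / d)      ∎
    where open ≡-Reasoning
  w^[n%d]≡1 : w ^ (n % d) ≡ + 1 mod m
  w^[n%d]≡1 = *-≡mod-1-cancelʳ (subst (_≡ + 1 mod m) split w^n≡1) (^-≡mod-1 (n / d) w^d≡1)

-- Arithmetic modulo a prime

prime∣^⇒∣ : ∀ {q m} → Prime q → ∀ n → q ∣ℕ m ^ℕ n → q ∣ℕ m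
prime∣^⇒∣ q-prime zero q∣1 =
  ⊥-elim (ℕP.<-irrefl (sym (ℕD.∣1⇒≡1 q∣1)) (ℕ.nonTrivial⇒n>1 _ {{prime⇒nonTrivial q-prime}}))
prime∣^⇒∣ {m = m} q-prime (suc n) q∣m*m^n with euclidsLemma m (m ^ℕ n) q-prime q∣m*m^n
... | inj₁ q∣m = q∣m
... | inj₂ q∣m^n = prime∣^⇒∣ q-prime n q∣m^n

pos-^ : ∀ p n → (+ p) ^ n ≡ + (p ^ℕ n)
pos-^ p zero = refl
pos-^ p (suc n) = trans (cong ((+ p) *_) (pos-^ p n)) (sym (ℤP.pos-* p (p ^ℕ n)))

module Modulo (p : ℕ) (p-prime : Prime p) where

  P : ℤ
  P = + p

  instance
    p≢0 : ℕ.NonZero p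
    p≢0 = prime⇒nonZero p-prime

  1<p : 1 < p
  1<p = ℕ.nonTrivial⇒n>1 p {{prime⇒nonTrivial p-prime}}

  p∣-* : ∀ {x y} → P ∣ x * y → P ∣ x ⊎ P ∣ y
  p∣-* {x} {y} P∣xy
    with euclidsLemma ℤ.∣ x ∣ ℤ.∣ y ∣ p-prime (subst (p ∣ℕ_) (ℤP.abs-* x y) (∣⇒∣ᵤ P∣xy))
  ... | inj₁ p∣x = inj₁ (∣ᵤ⇒∣ p∣x)
  ... | inj₂ p∣y = inj₂ (∣ᵤ⇒∣ p∣y)

  p∤-* : ∀ {x y} → ¬ P ∣ x → ¬ P ∣ y → ¬ P ∣ x * y
  p∤-* p∤x p∤y P∣xy with p∣-* P∣xy
  ... | inj₁ P∣x = p∤x P∣x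
  ... | inj₂ P∣y = p∤y P∣y

  p∤1 : ¬ P ∣ + 1
  p∤1 P∣1 = ℕP.<-irrefl (sym (ℕD.∣1⇒≡1 (∣⇒∣ᵤ P∣1))) 1<p

  p∤-^ : ∀ {w} n → ¬ P ∣ w → ¬ P ∣ w ^ n
  p∤-^ zero p∤w = p∤1
  p∤-^ (suc n) p∤w = p∤-* p∤w (p∤-^ n p∤w)

  *-cancelˡ-≡mod : ∀ {x u v} → ¬ P ∣ x → x * u ≡ x * v mod P → u ≡ v mod P
  *-cancelˡ-≡mod {x} {u} {v} p∤x (∣⇒≡mod P∣xu-xv) with p∣-* (subst (P ∣_) (eq x u v) P∣xu-xv)
    where
    eq : ∀ x u v → x * u - x * v ≡ x * (u - v)
    eq = solve-∀
  ... | inj₁ P∣x = ⊥-elim (p∤x P∣x)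
  ... | inj₂ P∣u-v = ∣⇒≡mod P∣u-v

  ≡mod-%ℕ : ∀ x → + (x %ℕ p) ≡ x mod P
  ≡mod-%ℕ x = ∣⇒≡mod (∣-scale (- (x /ℕ p)) eq ∣-refl)
    where
    eq : + (x %ℕ p) - x ≡ - (x /ℕ p) * P
    eq = begin
      + (x %ℕ p) - x                            ≡⟨ cong (λ t → + (x %ℕ p) - t) (a≡a%ℕn+[a/ℕn]*n x p) ⟩
      + (x %ℕ p) - (+ (x %ℕ p) + (x /ℕ p) * P)  ≡⟨ e (+ (x %ℕ p)) (x /ℕ p) P ⟩
      - (x /ℕ p) * P                            ∎
      where
      open ≡-Reasoning
      e : ∀ r q n → r - (r + q * n) ≡ - q * n
      e = solve-∀

  unit-power≡1 : ∀ {w} → ¬ P ∣ w → ∃[ n ] 0 < n × w ^ n ≡ + 1 mod P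
  unit-power≡1 {w} p∤w with FinP.pigeonhole (ℕP.n<1+n p) residue
    where
    residue : Fin (suc p) → Fin p
    residue i = Fin.fromℕ< (n%ℕd<d (w ^ Fin.toℕ i) p)
  ... | i , j , i<j , same-residue =
    J ℕ.∸ I , ℕP.m<n⇒0<n∸m i<j , ≡mod-sym (*-cancelˡ-≡mod (p∤-^ I p∤w) w^I*1≡w^I*w^[J∸I])
    where
    I J : ℕ
    I = Fin.toℕ i
    J = Fin.toℕ j
    w^I*1≡w^I*w^[J∸I] : w ^ I * + 1 ≡ w ^ I * w ^ (J ℕ.∸ I) mod P
    w^I*1≡w^I*w^[J∸I] = begin
      w ^ I * + 1             ≡⟨ ℤP.*-identityʳ (w ^ I) ⟩
      w ^ I                   ≈⟨ ≡mod-%ℕ (w ^ I) ⟨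
      + (w ^ I %ℕ p)          ≡⟨ cong +_ (FinP.fromℕ<-injective (w ^ I %ℕ p) (w ^ J %ℕ p)
                                    (n%ℕd<d (w ^ I) p) (n%ℕd<d (w ^ J) p) same-residue) ⟩
      + (w ^ J %ℕ p)          ≈⟨ ≡mod-%ℕ (w ^ J) ⟩
      w ^ J                   ≡⟨ cong (w ^_) (ℕP.m+[n∸m]≡n (ℕP.<⇒≤ i<j)) ⟨
      w ^ (I ℕ.+ (J ℕ.∸ I))   ≡⟨ ℤP.^-distribˡ-+-* w I (J ℕ.∸ I) ⟩
      w ^ I * w ^ (J ℕ.∸ I)   ∎
      where open ≡mod-Reasoning P

  unit-order : ∀ {w} → ¬ P ∣ w → ∃[ d ] IsOrder P w d
  unit-order p∤w = order-exists (unit-power≡1 p∤w)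

  ≡1-lift : ∀ {k w} → w ≡ + 1 mod P ^ suc k → w ^ p ≡ + 1 mod P ^ suc (suc k)
  ≡1-lift {k} {w} (∣⇒≡mod P^[1+k]∣w-1) =
    ∣⇒≡mod (subst (P ^ suc (suc k) ∣_) (sym (^-1≡[w-1]*geometric w p))
                  (∣-trans P^[2+k]∣[w-1]*P (*-monoʳ-∣ (w - + 1) P∣geometric)))
    where
    P^[2+k]∣[w-1]*P : P ^ suc (suc k) ∣ (w - + 1) * P
    P^[2+k]∣[w-1]*P = subst (P ^ suc (suc k) ∣_) (ℤP.*-comm P (w - + 1)) (*-monoʳ-∣ P P^[1+k]∣w-1)
    w≡1 : w ≡ + 1 mod P
    w≡1 = ≡mod-weaken (∣m⇒∣m*n (P ^ k) ∣-refl) (∣⇒≡mod P^[1+k]∣w-1)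
    P∣geometric : P ∣ geometric w p
    P∣geometric = ∣-linear (+ 1) (+ 1) (eq (geometric w p) P) (≡mod⇒∣ (geometric-≡mod w≡1 p)) ∣-refl
      where
      eq : ∀ g n → g ≡ + 1 * (g - n) + + 1 * n
      eq = solve-∀

  ^p^k-≡1 : ∀ {w} → w ≡ + 1 mod P → ∀ k → w ^ (p ^ℕ k) ≡ + 1 mod P ^ suc k
  ^p^k-≡1 {w} w≡1 zero =
    ≡mod-trans (≡mod-reflexive (ℤP.*-identityʳ w)) (≡mod-weaken (∣-reflexive (ℤP.*-identityʳ P)) w≡1)
  ^p^k-≡1 {w} w≡1 (suc k) =
    subst (_≡ + 1 mod P ^ suc (suc k)) w^[p^k]^p≡w^[p^[1+k]] (≡1-lift {k} (^p^k-≡1 w≡1 k))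
    where
    w^[p^k]^p≡w^[p^[1+k]] : (w ^ (p ^ℕ k)) ^ p ≡ w ^ (p ^ℕ suc k)
    w^[p^k]^p≡w^[p^[1+k]] = trans (ℤP.^-*-assoc w (p ^ℕ k) p) (cong (w ^_) (ℕP.*-comm (p ^ℕ k) p))

  lowest-term : ∀ {e u v} → P ^ e * u + v ≡ + 0 → P ^ suc e ∣ v → P ∣ u
  lowest-term {e} {u} {v} P^e*u+v≡0 P^[1+e]∣v =
    *-cancelˡ-∣ (P ^ e) (subst (_∣ P ^ e * u) (ℤP.*-comm P (P ^ e)) P^[1+e]∣P^e*u)
    where
    instance
      P^e≢0 : ℤ.NonZero (P ^ e)
      P^e≢0 = subst (ℕ.NonZero ∘ ℤ.∣_∣) (sym (pos-^ p e)) (ℕP.m^n≢0 p e)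
    eq : ∀ x v → x ≡ + 1 * (x + v) + - + 1 * v
    eq = solve-∀
    P^[1+e]∣P^e*u : P ^ suc e ∣ P ^ e * u
    P^[1+e]∣P^e*u = ∣-linear (+ 1) (- + 1) (eq (P ^ e * u) v)
                      (subst (P ^ suc e ∣_) (sym P^e*u+v≡0) (∣0 (P ^ suc e))) P^[1+e]∣v

  lowest-of-three : ∀ {e e' e'' u u' u''} → P ^ e * u + P ^ e' * u' + P ^ e'' * u'' ≡ + 0 →
                    e < e' → e < e'' → P ∣ u
  lowest-of-three {e} {e'} {e''} {u} {u'} {u''} sum≡0 e<e' e<e'' =
    lowest-term {e} (trans (sym (ℤP.+-assoc (P ^ e * u) (P ^ e' * u') (P ^ e'' * u''))) sum≡0)
                (∣m∣n⇒∣m+n (∣m⇒∣m*n u' (^-monoʳ-∣ P e<e')) (∣m⇒∣m*n u'' (^-monoʳ-∣ P e<e'')))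

  lowest-exponent-twice : ∀ {e₁ e₂ e₃ u₁ u₂ u₃} →
                          P ^ e₁ * u₁ + P ^ e₂ * u₂ + P ^ e₃ * u₃ ≡ + 0 →
                          ¬ P ∣ u₁ → ¬ P ∣ u₂ → ¬ P ∣ u₃ →
                          (e₁ ≡ e₂ × P ∣ u₁ + u₂) ⊎ e₁ ≡ e₃ ⊎ e₂ ≡ e₃
  lowest-exponent-twice {e₁} {e₂} {e₃} {u₁} {u₂} {u₃} sum≡0 p∤u₁ p∤u₂ p∤u₃ =
    cases (ℕP.<-cmp e₁ e₃) (ℕP.<-cmp e₂ e₃)
    where
    sum₂≡0 : P ^ e₂ * u₂ + P ^ e₁ * u₁ + P ^ e₃ * u₃ ≡ + 0
    sum₂≡0 = +-swap (P ^ e₁ * u₁) (P ^ e₂ * u₂) (P ^ e₃ * u₃) sum≡0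
    sum₃≡0 : P ^ e₃ * u₃ + P ^ e₁ * u₁ + P ^ e₂ * u₂ ≡ + 0
    sum₃≡0 = +-rotate (P ^ e₂ * u₂) (P ^ e₃ * u₃) (P ^ e₁ * u₁)
               (+-rotate (P ^ e₁ * u₁) (P ^ e₂ * u₂) (P ^ e₃ * u₃) sum≡0)
    cases : Tri (e₁ < e₃) (e₁ ≡ e₃) (e₃ < e₁) → Tri (e₂ < e₃) (e₂ ≡ e₃) (e₃ < e₂) →
            (e₁ ≡ e₂ × P ∣ u₁ + u₂) ⊎ e₁ ≡ e₃ ⊎ e₂ ≡ e₃
    cases (tri≈ _ e₁≡e₃ _) _ = inj₂ (inj₁ e₁≡e₃)
    cases _ (tri≈ _ e₂≡e₃ _) = inj₂ (inj₂ e₂≡e₃)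
    cases (tri> _ _ e₃<e₁) (tri> _ _ e₃<e₂) = ⊥-elim (p∤u₃ (lowest-of-three sum₃≡0 e₃<e₁ e₃<e₂))
    cases (tri< e₁<e₃ _ _) (tri> _ _ e₃<e₂) =
      ⊥-elim (p∤u₁ (lowest-of-three sum≡0 (ℕP.<-trans e₁<e₃ e₃<e₂) e₁<e₃))
    cases (tri> _ _ e₃<e₁) (tri< e₂<e₃ _ _) =
      ⊥-elim (p∤u₂ (lowest-of-three sum₂≡0 (ℕP.<-trans e₂<e₃ e₃<e₁) e₂<e₃))
    cases (tri< e₁<e₃ _ _) (tri< e₂<e₃ _ _) with ℕP.<-cmp e₁ e₂
    ... | tri< e₁<e₂ _ _ = ⊥-elim (p∤u₁ (lowest-of-three sum≡0 e₁<e₂ e₁<e₃))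
    ... | tri> _ _ e₂<e₁ = ⊥-elim (p∤u₂ (lowest-of-three sum₂≡0 e₂<e₁ e₂<e₃))
    ... | tri≈ _ refl _ =
      inj₁ (refl , lowest-term {e₁} P^e₁*[u₁+u₂]+P^e₃*u₃≡0 (∣m⇒∣m*n u₃ (^-monoʳ-∣ P e₁<e₃)))
      where
      P^e₁*[u₁+u₂]+P^e₃*u₃≡0 : P ^ e₁ * (u₁ + u₂) + P ^ e₃ * u₃ ≡ + 0
      P^e₁*[u₁+u₂]+P^e₃*u₃≡0 = trans (cong (_+ P ^ e₃ * u₃) (ℤP.*-distribˡ-+ (P ^ e₁) u₁ u₂)) sum≡0

  ≡mod-p^r⇒≡mod-p : ∀ {r x y} → 0 < r → x ≡ y mod + (p ^ℕ r) → x ≡ y mod P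
  ≡mod-p^r⇒≡mod-p {suc k} _ =
    ≡mod-weaken (subst (P ∣_) (sym (ℤP.pos-* p (p ^ℕ k))) (∣m⇒∣m*n (+ (p ^ℕ k)) ∣-refl))

  unit-inverse : ∀ {w} → ¬ P ∣ w → ∃[ w⁻¹ ] w * w⁻¹ ≡ + 1 mod P
  unit-inverse {w} p∤w = inverse (unit-power≡1 p∤w)
    where
    inverse : ∃[ n ] 0 < n × w ^ n ≡ + 1 mod P → ∃[ w⁻¹ ] w * w⁻¹ ≡ + 1 mod P
    inverse (suc n , _ , w^[1+n]≡1) = w ^ n , w^[1+n]≡1

  order⇒unit : ∀ {w d} → IsOrder P w d → ¬ P ∣ w
  order⇒unit {d = zero} ((() , _) , _)
  order⇒unit {w} {suc d} ((_ , ∣⇒≡mod P∣w^[1+d]-1) , _) P∣w =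
    p∤1 (∣-linear (w ^ d) (- + 1) (eq w (w ^ d)) P∣w P∣w^[1+d]-1)
    where
    eq : ∀ w v → + 1 ≡ v * w + - + 1 * (w * v - + 1)
    eq = solve-∀

  unit-≡1-mod-2 : p ≡ 2 → ∀ {w} → ¬ P ∣ w → w ≡ + 1 mod P
  unit-≡1-mod-2 refl {w} p∤w = residue-≡1 (w %ℕ 2) (n%ℕd<d w 2) (≡mod-%ℕ w)
    where
    residue-≡1 : ∀ k → k < 2 → + k ≡ w mod P → w ≡ + 1 mod P
    residue-≡1 zero _ 0≡w = ⊥-elim (p∤w (subst (P ∣_) (ℤP.+-identityʳ w) (≡mod⇒∣ (≡mod-sym 0≡w))))
    residue-≡1 (suc zero) _ 1≡w = ≡mod-sym 1≡w
    residue-≡1 (suc (suc _)) (s≤s (s≤s ())) _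

  module _ {a b Q : ℤ} (bQ+a≡0 : b * Q + a ≡ + 0 mod P) where

    root-unit : ¬ P ∣ a → ¬ P ∣ Q
    root-unit p∤a P∣Q = p∤a (∣-linear (+ 1) (- b) (eq a b Q) (≡mod⇒∣ bQ+a≡0) P∣Q)
      where
      eq : ∀ a b q → a ≡ + 1 * (b * q + a - + 0) + - b * q
      eq = solve-∀

    root-order>1 : ¬ P ∣ a + b → ∀ {d} → IsOrder P Q d → 1 < d
    root-order>1 p∤a+b {suc zero} ((_ , Q*1≡1) , _) =
      ⊥-elim (p∤a+b (∣-linear (+ 1) (- b) (eq a b Q) (≡mod⇒∣ bQ+a≡0) (≡mod⇒∣ Q*1≡1)))
      where
      eq : ∀ a b q → a + b ≡ + 1 * (b * q + a - + 0) + - b * (q * + 1 - + 1)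
      eq = solve-∀
    root-order>1 _ {suc (suc _)} _ = s≤s (s≤s z≤n)

    root-order : ¬ P ∣ a → ¬ P ∣ a + b → ∃[ d ] IsOrder P Q d × 1 < d
    root-order p∤a p∤a+b =
      let d , Q-order = unit-order (root-unit p∤a) in d , Q-order , root-order>1 p∤a+b Q-order

  order-even : ∀ {Q m d r} → 0 < r → IsOrder (+ (p ^ℕ r)) Q m → 2 ∣ℕ m →
               IsOrder P Q d → 1 < d → 2 ∣ℕ d
  order-even {Q} {m} {d} {suc k} _ m-order 2∣m d-order@((_ , Q^d≡1) , d-minimal) 1<d
    with euclidsLemma d (p ^ℕ k) prime[2] (ℕD.∣-trans 2∣m (order-∣ m-order Q^[d*p^k]≡1))
    where
    Q^[d*p^k]≡1 : Q ^ (d ℕ.* p ^ℕ k) ≡ + 1 mod + (p ^ℕ suc k)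
    Q^[d*p^k]≡1 = subst₂ (λ e n → e ≡ + 1 mod n) (ℤP.^-*-assoc Q d (p ^ℕ k)) (pos-^ p (suc k))
                         (^p^k-≡1 Q^d≡1 k)
  ... | inj₁ 2∣d = 2∣d
  ... | inj₂ 2∣p^k = ⊥-elim (d-minimal 1<d (s≤s z≤n , Q^1≡1))
    where
    p≡2 : p ≡ 2
    p≡2 = [ (λ ()) , sym ]′ (prime⇒irreducible p-prime (prime∣^⇒∣ prime[2] k 2∣p^k))
    Q^1≡1 : Q ^ 1 ≡ + 1 mod P
    Q^1≡1 = ≡mod-trans (≡mod-reflexive (ℤP.*-identityʳ Q)) (unit-≡1-mod-2 p≡2 (order⇒unit d-order))

-- Colouring the orbits of multiplication by Q

-- CyclicPred d i j: j precedes i on the cycle 0, 1, …, d - 1.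
data CyclicPred : ℕ → ℕ → ℕ → Set where
  pred-suc  : ∀ {d i} → CyclicPred d (suc i) i
  pred-zero : ∀ {n} → CyclicPred (suc n) 0 n

ProperCycleColouring : ∀ {K} d → (ℕ → Fin K) → Set
ProperCycleColouring d c = ∀ {i j} → i < d → CyclicPred d i j → c i ≢ c j

module OrbitColouring
  (p : ℕ) (p-prime : Prime p) {Q : ℤ} {n : ℕ} (Q-order : IsOrder (+ p) Q (suc n)) where
  open Modulo p p-prime

  Q^[1+j]*x : ∀ j x → Q ^ j * (Q * x) ≡ Q ^ suc j * x
  Q^[1+j]*x j x = eq (Q ^ j) Q x
    where
    eq : ∀ a q x → a * (q * x) ≡ (q * a) * x
    eq = solve-∀

  Q^[1+n]*x : ∀ x → Q ^ suc n * x ≡ x mod P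
  Q^[1+n]*x x = begin
    Q ^ suc n * x   ≡⟨ ℤP.*-comm (Q ^ suc n) x ⟩
    x * Q ^ suc n   ≈⟨ *-congˡ-≡mod x (proj₂ (proj₁ Q-order)) ⟩
    x * + 1         ≡⟨ ℤP.*-identityʳ x ⟩
    x               ∎
    where open ≡mod-Reasoning P

  InOrbit : ℤ → ℕ → Set
  InOrbit x y = ∃[ j ] j < suc n × + y ≡ Q ^ j * x mod P

  InOrbit? : ∀ x → Decidable (InOrbit x)
  InOrbit? x y = ℕP.anyUpTo? (λ j → + y ≡mod? Q ^ j * x) (suc n)

  InOrbit-≡mod : ∀ {x x'} → x ≡ x' mod P → InOrbit x ≐ InOrbit x'
  InOrbit-≡mod x≡x' =
    (λ (j , j<1+n , y≡Q^jx) → j , j<1+n , ≡mod-trans y≡Q^jx (*-congˡ-≡mod (Q ^ j) x≡x')) ,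
    (λ (j , j<1+n , y≡Q^jx') → j , j<1+n , ≡mod-trans y≡Q^jx' (*-congˡ-≡mod (Q ^ j) (≡mod-sym x≡x')))

  InOrbit-Q : ∀ x → InOrbit (Q * x) ≐ InOrbit x
  InOrbit-Q x = from , to
    where
    from : ∀ {y} → InOrbit (Q * x) y → InOrbit x y
    from {y} (j , j<1+n , y≡Q^j*Qx) with ℕP.m<1+n⇒m<n∨m≡n j<1+n
    ... | inj₁ j<n = suc j , s≤s j<n , y≡Q^[1+j]*x
      where
      y≡Q^[1+j]*x : + y ≡ Q ^ suc j * x mod P
      y≡Q^[1+j]*x = ≡mod-trans y≡Q^j*Qx (≡mod-reflexive (Q^[1+j]*x j x))
    ... | inj₂ refl = 0 , s≤s z≤n , y≡1*x
      where
      y≡1*x : + y ≡ + 1 * x mod P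
      y≡1*x = begin
        + y              ≈⟨ y≡Q^j*Qx ⟩
        Q ^ j * (Q * x)  ≡⟨ Q^[1+j]*x j x ⟩
        Q ^ suc n * x    ≈⟨ Q^[1+n]*x x ⟩
        x                ≡⟨ ℤP.*-identityˡ x ⟨
        + 1 * x          ∎
        where open ≡mod-Reasoning P
    to : ∀ {y} → InOrbit x y → InOrbit (Q * x) y
    to {y} (zero , _ , y≡1*x) = n , ℕP.n<1+n n , y≡Q^n*Qx
      where
      y≡Q^n*Qx : + y ≡ Q ^ n * (Q * x) mod P
      y≡Q^n*Qx = begin
        + y              ≈⟨ y≡1*x ⟩
        + 1 * x          ≡⟨ ℤP.*-identityˡ x ⟩
        x                ≈⟨ Q^[1+n]*x x ⟨
        Q ^ suc n * x    ≡⟨ Q^[1+j]*x n x ⟨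
        Q ^ n * (Q * x)  ∎
        where open ≡mod-Reasoning P
    to (suc j , s≤s j<n , y≡Q^[1+j]*x) =
      j , ℕP.m<n⇒m<1+n j<n , ≡mod-trans y≡Q^[1+j]*x (≡mod-reflexive (sym (Q^[1+j]*x j x)))

  residue-in-orbit : ∀ x → InOrbit x (x %ℕ p)
  residue-in-orbit x = 0 , s≤s z≤n , ≡mod-trans (≡mod-%ℕ x) (≡mod-reflexive (sym (ℤP.*-identityˡ x)))

  abstract
    representative : ℤ → ℕ
    representative x = proj₁ (least (InOrbit? x) (residue-in-orbit x))

    representative-least : ∀ x → Least (InOrbit x) (representative x)
    representative-least x = proj₂ (proj₂ (least (InOrbit? x) (residue-in-orbit x)))

  representative-≡mod : ∀ {x x'} → x ≡ x' mod P → representative x ≡ representative x'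
  representative-≡mod {x} {x'} x≡x' =
    Least-unique (Least-≐ (InOrbit-≡mod x≡x') (representative-least x)) (representative-least x')

  representative-Q : ∀ x → representative (Q * x) ≡ representative x
  representative-Q x =
    Least-unique (Least-≐ (InOrbit-Q x) (representative-least (Q * x))) (representative-least x)

  -- Orbits are labelled by their least natural representative; the index of x is its discrete
  -- logarithm to base Q relative to that label, and multiplying by Q moves it one step back.
  Index : ℤ → ℕ → Set
  Index x j = + representative x ≡ Q ^ j * x mod P

  Index-≡mod : ∀ {x x'} → x ≡ x' mod P → Index x ≐ Index x'
  Index-≡mod {x} {x'} x≡x' =
    (λ {j} r≡Q^jx → subst (λ r → + r ≡ Q ^ j * x' mod P) (representative-≡mod x≡x')
                      (≡mod-trans r≡Q^jx (*-congˡ-≡mod (Q ^ j) x≡x'))) ,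
    (λ {j} r≡Q^jx' → subst (λ r → + r ≡ Q ^ j * x mod P) (sym (representative-≡mod x≡x'))
                       (≡mod-trans r≡Q^jx' (*-congˡ-≡mod (Q ^ j) (≡mod-sym x≡x'))))

  Index-Q⁺ : ∀ {x j} → Index (Q * x) j → Index x (suc j)
  Index-Q⁺ {x} {j} r≡Q^j*Qx = subst (λ r → + r ≡ Q ^ suc j * x mod P) (representative-Q x)
                                (≡mod-trans r≡Q^j*Qx (≡mod-reflexive (Q^[1+j]*x j x)))

  Index-Q⁻ : ∀ {x j} → Index x (suc j) → Index (Q * x) j
  Index-Q⁻ {x} {j} r≡Q^[1+j]x = subst (λ r → + r ≡ Q ^ j * (Q * x) mod P) (sym (representative-Q x))
                                  (≡mod-trans r≡Q^[1+j]x (≡mod-reflexive (sym (Q^[1+j]*x j x))))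

  Index? : ∀ x → Decidable (Index x)
  Index? x j = + representative x ≡mod? Q ^ j * x

  index-search : ∀ x → ∃[ i ] i ≤ proj₁ (proj₁ (representative-least x)) × Least (Index x) i
  index-search x = least (Index? x) (proj₂ (proj₂ (proj₁ (representative-least x))))

  abstract
    index : ℤ → ℕ
    index x = proj₁ (index-search x)

    index-least : ∀ x → Least (Index x) (index x)
    index-least x = proj₂ (proj₂ (index-search x))

    index<1+n : ∀ x → index x < suc n
    index<1+n x =
      ℕP.≤-<-trans (proj₁ (proj₂ (index-search x))) (proj₁ (proj₂ (proj₁ (representative-least x))))

  index-≡mod : ∀ {x x'} → x ≡ x' mod P → index x ≡ index x'
  index-≡mod {x} {x'} x≡x' = Least-unique (Least-≐ (Index-≡mod x≡x') (index-least x)) (index-least x')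

  index-Q-suc : ∀ {x i} → index x ≡ suc i → index (Q * x) ≡ i
  index-Q-suc {x} {i} index≡1+i =
    Least-unique (index-least (Q * x)) (Index-Q⁻ {x} {i} Index-x-[1+i] , i-least)
    where
    Index-x-[1+i] : Index x (suc i)
    Index-x-[1+i] = subst (Index x) index≡1+i (proj₁ (index-least x))
    i-least : ∀ {j} → j < i → ¬ Index (Q * x) j
    i-least {j} j<i Index-Qx-j =
      proj₂ (index-least x) (subst (suc j <_) (sym index≡1+i) (s≤s j<i)) (Index-Q⁺ {x} {j} Index-Qx-j)

  index-Q-zero : ∀ {x} → ¬ P ∣ x → index x ≡ 0 → index (Q * x) ≡ n
  index-Q-zero {x} p∤x index≡0 =
    Least-unique (index-least (Q * x)) (Index-Q⁻ {x} {n} Index-x-[1+n] , n-least)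
    where
    r≡x : + representative x ≡ x mod P
    r≡x = ≡mod-trans (subst (Index x) index≡0 (proj₁ (index-least x))) (≡mod-reflexive (ℤP.*-identityˡ x))
    Index-x-[1+n] : Index x (suc n)
    Index-x-[1+n] = ≡mod-trans r≡x (≡mod-sym (Q^[1+n]*x x))
    n-least : ∀ {j} → j < n → ¬ Index (Q * x) j
    n-least {j} j<n Index-Qx-j = proj₂ Q-order (s≤s j<n) (s≤s z≤n , Q^[1+j]≡1)
      where
      Q^[1+j]≡1 : Q ^ suc j ≡ + 1 mod P
      Q^[1+j]≡1 = *-cancelˡ-≡mod p∤x (begin
        x * Q ^ suc j    ≡⟨ ℤP.*-comm x (Q ^ suc j) ⟩
        Q ^ suc j * x    ≈⟨ Index-Q⁺ {x} {j} Index-Qx-j ⟨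
        + representative x ≈⟨ r≡x ⟩
        x                ≡⟨ ℤP.*-identityʳ x ⟨
        x * + 1          ∎)
        where open ≡mod-Reasoning P

  index-Q : ∀ {x} → ¬ P ∣ x → CyclicPred (suc n) (index x) (index (Q * x))
  index-Q {x} p∤x with index x in index≡i
  ... | zero = subst (CyclicPred (suc n) 0) (sym (index-Q-zero p∤x index≡i)) pred-zero
  ... | suc i = subst (CyclicPred (suc n) (suc i)) (sym (index-Q-suc index≡i)) pred-suc

  orbitColouring : ∀ {K} → (ℕ → Fin K) → ℤ → Fin K
  orbitColouring c x = c (index x)

  orbitColouring-Q : ∀ {K} {c : ℕ → Fin K} → ProperCycleColouring (suc n) c →
                     ∀ {x y} → ¬ P ∣ x → y ≡ Q * x mod P → orbitColouring c x ≢ orbitColouring c y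
  orbitColouring-Q {c = c} proper {x} {y} p∤x y≡Qx cx≡cy =
    proper (index<1+n x) (index-Q p∤x) (trans cx≡cy (cong c (index-≡mod y≡Qx)))

-- Proper colourings of cycles

parity : ℕ → Fin 2
parity zero = Fin.zero
parity (suc n) = Fin.opposite (parity n)

parity-suc : ∀ n → parity (suc n) ≢ parity n
parity-suc n = opposite-≢ (parity n)
  where
  opposite-≢ : ∀ (b : Fin 2) → Fin.opposite b ≢ b
  opposite-≢ Fin.zero = λ ()
  opposite-≢ (Fin.suc Fin.zero) = λ ()

parity-even : ∀ q → parity (q ℕ.* 2) ≡ Fin.zero
parity-even zero = refl
parity-even (suc q) rewrite parity-even q = refl

parity-proper : ∀ {d} → 2 ∣ℕ d → ProperCycleColouring d parity
parity-proper _ _ (pred-suc {i = i}) = parity-suc i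
parity-proper {suc n} (ℕD.divides q 1+n≡q*2) _ pred-zero 0≡parity-n =
  parity-suc n (trans (trans (cong parity 1+n≡q*2) (parity-even q)) 0≡parity-n)

threeColouring : ℕ → ℕ → Fin 3
threeColouring n i with i ℕ.≟ n
... | yes _ = Fin.fromℕ 2
... | no _ = Fin.inject₁ (parity i)

threeColouring-proper : ∀ {n} → 1 ≤ n → ProperCycleColouring (suc n) (threeColouring n)
threeColouring-proper {n} _ (s≤s i<n) (pred-suc {i = i}) with suc i ℕ.≟ n | i ℕ.≟ n
... | _ | yes refl = ⊥-elim (ℕP.<-irrefl refl i<n)
... | yes _ | no _ = FinP.fromℕ≢inject₁
... | no _ | no _ = parity-suc i ∘ FinP.inject₁-injective
threeColouring-proper {n} 1≤n _ pred-zero with 0 ℕ.≟ n | n ℕ.≟ n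
... | yes refl | _ = ⊥-elim (ℕP.<-irrefl refl 1≤n)
... | no _ | yes _ = FinP.fromℕ≢inject₁ ∘ sym
... | no _ | no n≢n = ⊥-elim (n≢n refl)

CycleColourable : ℕ → ℕ → Set
CycleColourable K d = ∃[ χ ] ProperCycleColouring {K} d χ

even-cycle-2-colourable : ∀ {d} → 2 ∣ℕ d → CycleColourable 2 d
even-cycle-2-colourable 2∣d = parity , parity-proper 2∣d

cycle-3-colourable : ∀ {d} → 1 < d → CycleColourable 3 d
cycle-3-colourable {suc n} (s≤s 1≤n) = threeColouring n , threeColouring-proper 1≤n

-- Colouring the positive integers

record PowerSplit (p n : ℕ) : Set where
  constructor powerSplit
  field
    v u : ℕ
    n≡p^v*u : n ≡ p ^ℕ v ℕ.* u
    p∤u : ¬ p ∣ℕ u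

split-power : ∀ {p} → 1 < p → ∀ n → 0 < n → PowerSplit p n
split-power {p} 1<p n = go n (ℕI.<-wellFounded n)
  where
  go : ∀ n → Acc _<_ n → 0 < n → PowerSplit p n
  go n (acc rec) 0<n with p ℕD.∣? n
  ... | no p∤n = powerSplit 0 n (sym (ℕP.+-identityʳ n)) p∤n
  ... | yes (ℕD.divides zero n≡0*p) = ⊥-elim (ℕP.<-irrefl (sym n≡0*p) 0<n)
  ... | yes (ℕD.divides q@(suc _) n≡q*p) =
    powerSplit (suc v) u (trans n≡q*p (trans (cong (ℕ._* p) q≡p^v*u) (eq (p ^ℕ v) u p))) p∤u
    where
    q<n : q < n
    q<n = subst (q <_) (sym n≡q*p) (ℕP.m<m*n q p 1<p)
    open PowerSplit (go q (rec q<n) (s≤s z≤n)) renaming (n≡p^v*u to q≡p^v*u)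
    eq : ∀ a u p → a ℕ.* u ℕ.* p ≡ p ℕ.* a ℕ.* u
    eq = ℕSolver.solve-∀

colouring⇒DorLessThan : ∀ {E K} (χ : ℕ → Fin K) →
                        (∀ {x y z} → SolvesPos E x y z → χ x ≡ χ y → χ y ≡ χ z → ⊥) →
                        DorLessThan E K
colouring⇒DorLessThan χ no-monochromatic k K≤k k-regular =
  let x , y , z , solution , χx≡χy , χy≡χz = k-regular (λ n → Fin.inject≤ (χ n) K≤k)
  in no-monochromatic solution (FinP.inject≤-injective K≤k K≤k _ _ χx≡χy)
                               (FinP.inject≤-injective K≤k K≤k _ _ χy≡χz)

module NoMonochromaticSolution
  (p : ℕ) (p-prime : Prime p) {a b c c' : ℤ} {r : ℕ} (0<r : 0 < r)
  (p∤a : ¬ + p ∣ a) (p∤b : ¬ + p ∣ b) (p∤c' : ¬ + p ∣ c') (c≡c'*p^r : c ≡ c' * (+ p) ^ r)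
  {Q : ℤ} (bQ+a≡0 : b * Q + a ≡ + 0 mod + p)
  {K : ℕ} (χ : ℤ → Fin K) (χ-Q : ∀ {x y} → ¬ + p ∣ x → y ≡ Q * x mod + p → χ x ≢ χ y) where

  open Modulo p p-prime

  instance
    r≢0 : ℕ.NonZero r
    r≢0 = ℕ.>-nonZero 0<r

  abstract
    split : ∀ n → PowerSplit p (suc n)
    split n = split-power 1<p (suc n) (s≤s z≤n)

  colour : ℕ → Fin 2 × Fin K
  colour zero = Fin.zero , χ (+ 0)
  colour (suc n) = parity (v / r) , χ (+ u)
    where open PowerSplit (split n)

  parity-shift : ∀ γ → parity ((γ ℕ.+ r) / r) ≢ parity (γ / r)
  parity-shift γ = subst (λ k → parity k ≢ parity (γ / r)) (sym [γ+r]/r≡1+γ/r) (parity-suc (γ / r))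
    where
    [γ+r]/r≡1+γ/r : (γ ℕ.+ r) / r ≡ suc (γ / r)
    [γ+r]/r≡1+γ/r = trans (m/n≡1+[m∸n]/n (ℕP.m≤n+m r γ)) (cong (λ k → suc (k / r)) (ℕP.m+n∸n≡m γ r))

  ≡Q* : ∀ {x y} → P ∣ a * x + b * y → y ≡ Q * x mod P
  ≡Q* {x} {y} P∣ax+by with p∣-* (∣-linear (+ 1) (- x) (eq a b Q x y) P∣ax+by (≡mod⇒∣ bQ+a≡0))
    where
    eq : ∀ a b q x y → b * (y - q * x) ≡ + 1 * (a * x + b * y) + - x * (b * q + a - + 0)
    eq = solve-∀
  ... | inj₁ P∣b = ⊥-elim (p∤b P∣b)
  ... | inj₂ P∣y-Qx = ∣⇒≡mod P∣y-Qx

  pos-split : ∀ {n} (s : PowerSplit p n) → + n ≡ P ^ PowerSplit.v s * + PowerSplit.u s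
  pos-split (powerSplit v u n≡p^v*u _) =
    trans (cong +_ n≡p^v*u) (trans (ℤP.pos-* (p ^ℕ v) u) (cong (_* + u) (sym (pos-^ p v))))

  p∤-split : ∀ {n} (s : PowerSplit p n) → ¬ P ∣ + PowerSplit.u s
  p∤-split s P∣u = PowerSplit.p∤u s (∣⇒∣ᵤ P∣u)

  colour-solution : ∀ {x y z} → SolvesPos (eqn a b c) x y z →
                    colour x ≡ colour y → colour y ≡ colour z → ⊥
  colour-solution {suc x} {suc y} {suc z} (_ , _ , _ , sum≡0) cx≡cy cy≡cz =
    cases (lowest-exponent-twice split-sum≡0 (p∤-* p∤a (p∤-split (split x)))
                                             (p∤-* p∤b (p∤-split (split y)))
                                             (p∤-* p∤c' (p∤-split (split z))))
    where
    open PowerSplit (split x) using () renaming (v to α; u to x')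
    open PowerSplit (split y) using () renaming (v to β; u to y')
    open PowerSplit (split z) using () renaming (v to γ; u to z')
    eq : ∀ a b c' A B C R x y z →
         A * (a * x) + B * (b * y) + C * R * (c' * z) ≡ a * (A * x) + b * (B * y) + c' * R * (C * z)
    eq = solve-∀
    split-sum≡0 : P ^ α * (a * + x') + P ^ β * (b * + y') + P ^ (γ ℕ.+ r) * (c' * + z') ≡ + 0
    split-sum≡0 = begin
      P ^ α * (a * + x') + P ^ β * (b * + y') + P ^ (γ ℕ.+ r) * (c' * + z')
        ≡⟨ cong (λ t → P ^ α * (a * + x') + P ^ β * (b * + y') + t * (c' * + z'))
                (ℤP.^-distribˡ-+-* P γ r) ⟩
      P ^ α * (a * + x') + P ^ β * (b * + y') + P ^ γ * P ^ r * (c' * + z')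
        ≡⟨ eq a b c' (P ^ α) (P ^ β) (P ^ γ) (P ^ r) (+ x') (+ y') (+ z') ⟩
      a * (P ^ α * + x') + b * (P ^ β * + y') + c' * P ^ r * (P ^ γ * + z')
        ≡⟨ cong₂ _+_ (cong₂ _+_ (cong (a *_) (pos-split (split x))) (cong (b *_) (pos-split (split y))))
                     (cong₂ _*_ c≡c'*p^r (pos-split (split z))) ⟨
      a * + suc x + b * + suc y + c * + suc z
        ≡⟨ sum≡0 ⟩
      + 0 ∎
      where open ≡-Reasoning
    same-parity : ∀ {e} → parity (e / r) ≡ parity (γ / r) → e ≢ γ ℕ.+ r
    same-parity same refl = parity-shift γ same
    cases : (α ≡ β × P ∣ a * + x' + b * + y') ⊎ α ≡ γ ℕ.+ r ⊎ β ≡ γ ℕ.+ r → ⊥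
    cases (inj₁ (_ , P∣ax'+by')) = χ-Q (p∤-split (split x)) (≡Q* P∣ax'+by') (cong proj₂ cx≡cy)
    cases (inj₂ (inj₁ α≡γ+r)) = same-parity (cong proj₁ (trans cx≡cy cy≡cz)) α≡γ+r
    cases (inj₂ (inj₂ β≡γ+r)) = same-parity (cong proj₁ cy≡cz) β≡γ+r

  dor<2K : DorLessThan (eqn a b c) (2 ℕ.* K)
  dor<2K = colouring⇒DorLessThan {eqn a b c} (uncurry Fin.combine ∘ colour)
    λ solution cx≡cy cy≡cz → colour-solution solution (combine-injective cx≡cy) (combine-injective cy≡cz)
    where
    combine-injective : ∀ {m n} → uncurry Fin.combine (colour m) ≡ uncurry Fin.combine (colour n) →
                        colour m ≡ colour n
    combine-injective = ×-≡,≡→≡ ∘ FinP.combine-injective _ _ _ _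

Valuation-0⇒∤ : ∀ {p x} → Valuation p x 0 → ¬ + p ∣ x
Valuation-0⇒∤ {p} (_ , _ , p^1∤x) P∣x =
  p^1∤x (∣⇒∣ᵤ (∣-trans (∣-reflexive (ℤP.*-identityʳ (+ p))) P∣x))

Valuation⇒split : ∀ {p x v} → Valuation p x v → ∃[ x' ] x ≡ x' * (+ p) ^ v × ¬ + p ∣ x'
Valuation⇒split {p} {x} {v} (_ , p^v∣x , p^[1+v]∤x) with ∣ᵤ⇒∣ p^v∣x
... | divides x' x≡x'*p^v = x' , x≡x'*p^v , p∤x'
  where
  p∤x' : ¬ + p ∣ x'
  p∤x' (divides t x'≡t*p) = p^[1+v]∤x (∣⇒∣ᵤ (divides t (begin
    x                          ≡⟨ x≡x'*p^v ⟩
    x' * (+ p) ^ v             ≡⟨ cong (_* (+ p) ^ v) x'≡t*p ⟩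
    t * + p * (+ p) ^ v        ≡⟨ ℤP.*-assoc t (+ p) ((+ p) ^ v) ⟩
    t * (+ p) ^ suc v          ∎)))
    where open ≡-Reasoning

IsMultOrder⇒IsOrder : ∀ {n g m} → IsMultOrder n g m → IsOrder (+ n) g m
IsMultOrder⇒IsOrder (0<m , n∣g^m-1 , m-minimal) =
  (0<m , ∣⇒≡mod (∣ᵤ⇒∣ n∣g^m-1)) ,
  λ j<m (0<j , g^j≡1) → m-minimal _ 0<j j<m (∣⇒∣ᵤ (≡mod⇒∣ g^j≡1))

dor-bound : ∀ {p a b c r Q d K} → Prime p → 0 < r →
            ¬ + p ∣ a → ¬ + p ∣ b → Valuation p c r →
            b * Q + a ≡ + 0 mod + p → IsOrder (+ p) Q d → CycleColourable K d →
            DorLessThan (eqn a b c) (2 ℕ.* K)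
dor-bound {d = zero} _ _ _ _ _ _ ((() , _) , _) _
dor-bound {p} {c = c} {r} {d = suc n} p-prime 0<r p∤a p∤b vc bQ+a≡0 Q-order (χ , proper) =
  let c' , c≡c'*p^r , p∤c' = Valuation⇒split {p} {c} {r} vc
  in NoMonochromaticSolution.dor<2K p p-prime 0<r p∤a p∤b p∤c' c≡c'*p^r bQ+a≡0
       (orbitColouring χ) (orbitColouring-Q proper)
  where open OrbitColouring p p-prime Q-order

root-of-inverse : ∀ {m} a b b⁻¹ → b * b⁻¹ ≡ + 1 mod m → b * (- a * b⁻¹) + a ≡ + 0 mod m
root-of-inverse a b b⁻¹ (∣⇒≡mod m∣bb⁻¹-1) = ∣⇒≡mod (∣-scale (- a) (eq a b b⁻¹) m∣bb⁻¹-1)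
  where
  eq : ∀ a b b⁻¹ → b * (- a * b⁻¹) + a - + 0 ≡ - a * (b * b⁻¹ - + 1)
  eq = solve-∀

lemma4 : (a b c : ℤ) → ¬ (a ≡ + 0) → ¬ (b ≡ + 0) → ¬ (c ≡ + 0) →
         ¬ Regular (eqn a b c) →
         (p r : ℕ) → Prime p →
         Valuation p a 0 → Valuation p b 0 → Valuation p (a + b) 0 →
         Valuation p c r → 0 < r →
         DorLessThan (eqn a b c) 6 ×
         ((binv : ℤ) → IsInverseMod (p ^ℕ r) b binv →
          (m : ℕ) → IsMultOrder (p ^ℕ r) (- a * binv) m → 2 ∣ℕ m →
          DorLessThan (eqn a b c) 4)
lemma4 a b c _ _ _ _ p r p-prime va vb va+b vc 0<r = dor<6 , dor<4
  where
  open Modulo p p-prime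

  bound : ∀ {Q d K} → b * Q + a ≡ + 0 mod P → IsOrder P Q d → CycleColourable K d →
          DorLessThan (eqn a b c) (2 ℕ.* K)
  bound = dor-bound p-prime 0<r (Valuation-0⇒∤ va) (Valuation-0⇒∤ vb) vc

  order : ∀ {Q} → b * Q + a ≡ + 0 mod P → ∃[ d ] IsOrder P Q d × 1 < d
  order root = root-order root (Valuation-0⇒∤ va) (Valuation-0⇒∤ va+b)

  dor<6 : DorLessThan (eqn a b c) 6
  dor<6 =
    let b⁻¹ , bb⁻¹≡1 = unit-inverse (Valuation-0⇒∤ vb)
        root = root-of-inverse a b b⁻¹ bb⁻¹≡1
        _ , Q-order , 1<d = order root
    in bound root Q-order (cycle-3-colourable 1<d)

  dor<4 : (b⁻¹ : ℤ) → IsInverseMod (p ^ℕ r) b b⁻¹ →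
          (m : ℕ) → IsMultOrder (p ^ℕ r) (- a * b⁻¹) m → 2 ∣ℕ m → DorLessThan (eqn a b c) 4
  dor<4 b⁻¹ bb⁻¹≡1 m m-order 2∣m =
    let root = root-of-inverse a b b⁻¹ (≡mod-p^r⇒≡mod-p 0<r (∣⇒≡mod (∣ᵤ⇒∣ bb⁻¹≡1)))
        _ , Q-order , 1<d = order root
        2∣d = order-even 0<r (IsMultOrder⇒IsOrder m-order) 2∣m Q-order 1<d
    in bound root Q-order (even-cycle-2-colourable 2∣d)
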